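{- Let $m\geq0$ and $n\geq1$ be integers and let $1\leq r\leq n+m$; if $r=1$ assume $m\in\{0,1\}$. Then for every $c\in\mathcal{C}_{n,m}$, $$\pi_r\bigl(\Psi_{n,m}(c)\bigr)=\Psi_{n,m}\bigl(\beta_r(c)\bigr).$$
   Context: $\mathcal{C}_{n,m}$ is the set of column-strict plane partitions $c=(c_{ij})$ (positive integer entries, partition shape, weakly decreasing along rows, strictly decreasing down columns) with at most $n$ columns and every part in column $j$ at most $n+m-j$; such a part equal to $n+m-j$ is saturated. $\mathcal{B}_{n,m}$ is the set of arrays $b=(b_{ij})_{1\leq i\leq j\leq n+m-1}$ weakly decreasing along rows and columns with $\max\{n-i,0\}\leq b_{ij}\leq n$; conventions $b_{i,n+m}=n-i$, $b_{0,j}=n$. For $c\in\mathcal{C}_{n,m}$ let $\ell_i^{k}(c)=\#\{l: c_{il}\geq k\}$. The map $\Psi_{n,m}:\mathcal{C}_{n,m}\to\mathcal{B}_{n,m}$ is defined by $n-b_{ij}=\ell^{\,1-i+j}_{n+m-j}(c)$ for $1\le i\le j\le n+m-1$ (it is a bijection). Flip of an off-diagonal entry $b_{ij}$ ($i<j$): replace it by $\min(b_{i-1,j},b_{i,j-1})+\max(b_{i,j+1},b_{i+1,j})-b_{ij}$; flip of a diagonal entry $b_{ii}$: replace it by $b_{i-1,i}+b_{i,i+1}-b_{ii}$. $\pi_r$ flips simultaneously all $b_{i,i+r-1}$, $1\leq i\leq n+m-r$. Twisted Bender–Knuth map $\beta_r$ for $2\leq r\leq n+m$: in $c$, ignore each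 column containing both an $r$ and an $r-1$, and ignore an entry $r-1$ in column $n+m-r+1$; in each row the remaining entries equal to $r$ or $r-1$ are $k$ entries $r$ followed by $l$ entries $r-1$; replace them by $l$ entries $r$ followed by $k$ entries $r-1$. For $r=1$ (with $m\in\{0,1\}$): let $\lambda_i$ be the number of parts $\geq2$ in row $i$ and $\lambda_0=n+m-1$; if row $i$ ($1\le i\le n+m-1$) contains $k$ ones (necessarily in columns $\lambda_i+1,\dots,\lambda_i+k$, with $k\le \lambda_{i-1}-\lambda_i$), $\beta_1(c)$ replaces them by $\lambda_{i-1}-\lambda_i-k$ ones in columns $\lambda_i+1,\dots,\lambda_{i-1}-k$. -}

module Defs where

open import Data.Nat using (ℕ; zero; suc; _+_; _∸_; _≤_; _<_; _≤ᵇ_; _<ᵇ_; _≡ᵇ_; _⊓_; _⊔_)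
open import Data.Bool using (Bool; true; false; if_then_else_; _∧_; _∨_; not)
open import Relation.Binary.PropositionalEquality using (_≡_)

-- A plane partition c = (c_{ij})_{i,j ≥ 1} is stored as a function
-- PP = ℕ → ℕ → ℕ, 0-INDEXED: (c i j) is the paper's entry c_{i+1,j+1},
-- and the value 0 means "no cell" (all genuine entries are positive
-- integers, so the shape is exactly the support {(i,j) | c i j > 0}).
--
-- An array b = (b_{ij}) is stored as a function Arr = ℕ → ℕ → ℕ,
-- 1-INDEXED: (b i j) is the paper's b_{ij}; only the values with
-- 1 ≤ i ≤ j ≤ n+m-1 are meaningful.

PP : Set
PP = ℕ → ℕ → ℕ

Arr : Set
Arr = ℕ → ℕ → ℕ

count : ℕ → (ℕ → Bool) → ℕ
count zero    p = 0
count (suc N) p = (if p N then 1 else 0) + count N p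

anyBelow : ℕ → (ℕ → Bool) → Bool
anyBelow zero    p = false
anyBelow (suc N) p = p N ∨ anyBelow N p

record InC (n m : ℕ) (c : PP) : Set where
  field
    atMostNCols   : ∀ i j → n ≤ j → c i j ≡ 0
    -- rows weakly decreasing (with 0 = no cell this also says that the
    -- support is left-justified, i.e. rows are left-justified)
    rowWeak       : ∀ i j → c i (suc j) ≤ c i j
    -- columns strictly decreasing (with 0 = no cell this also says that
    -- the support is top-justified; together: the shape is a partition)
    colStrict     : ∀ i j → 0 < c (suc i) j → c (suc i) j < c i j
    colBound      : ∀ i j → c i j ≤ n + m ∸ suc j

-- ℓ^k_i(c) for a 1-indexed row i ≥ 1 (columns l range over 1..n, since
-- c has at most n columns)
ell : (n : ℕ) → PP → (i k : ℕ) → ℕ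
ell n c i k = count n (λ l → k ≤ᵇ c (i ∸ 1) l)

Ψ : (n m : ℕ) → PP → Arr
Ψ n m c i j = n ∸ ell n c (n + m ∸ j) (suc j ∸ i)

-- the array with the boundary conventions b_{0,j} = n, b_{i,n+m} = n-i
ext : (n m : ℕ) → Arr → Arr
ext n m b i j =
  if i ≡ᵇ 0 then n else (if j ≡ᵇ (n + m) then n ∸ i else b i j)

flipAt : (n m : ℕ) → Arr → ℕ → ℕ → ℕ
flipAt n m b i j =
  if i ≡ᵇ j
  then (e (i ∸ 1) i + e i (suc i)) ∸ e i i
  else ((e (i ∸ 1) j ⊓ e i (j ∸ 1)) + (e i (suc j) ⊔ e (suc i) j)) ∸ e i j
  where
  e : Arr
  e = ext n m b

π : (n m r : ℕ) → Arr → Arr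
π n m r b i j = if j ≡ᵇ (i + r ∸ 1) then flipAt n m b i j else b i j

-- does (0-indexed) column j of c contain the value v?  (Rows of a
-- member of C_{n,m} have index < n+m-1, so searching rows < n+m is a
-- search over the whole column.)
colHas : (n m : ℕ) → PP → ℕ → ℕ → Bool
colHas n m c j v = anyBelow (n + m) (λ i → c i j ≡ᵇ v)

-- r ≥ 2: is the entry at (0-indexed) (i,j) a free r or r-1, i.e. equal
-- to r or r-1, not in a column containing both r and r-1, and not an
-- entry r-1 in (1-indexed) column n+m-r+1 (0-indexed column n+m-r)?
free : (n m r : ℕ) → PP → ℕ → ℕ → Bool
free n m r c i j =
  ((c i j ≡ᵇ r) ∨ (c i j ≡ᵇ (r ∸ 1)))
  ∧ not (colHas n m c j r ∧ colHas n m c j (r ∸ 1))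
  ∧ not ((c i j ≡ᵇ (r ∸ 1)) ∧ (j ≡ᵇ (n + m ∸ r)))

-- r ≥ 2: in row i the free entries (in column order) are k entries r
-- followed by l entries r-1; they are replaced by l entries r followed
-- by k entries r-1 (in the same cells, in column order).
βBK : (n m r : ℕ) → PP → PP
βBK n m r c i j =
  if free n m r c i j
  then (if count j (free n m r c i) <ᵇ l then r else r ∸ 1)
  else c i j
  where
  l : ℕ
  l = count n (λ j' → free n m r c i j' ∧ (c i j' ≡ᵇ (r ∸ 1)))

-- r = 1: λ_0 = n+m-1, λ_i = number of parts ≥ 2 in (1-indexed) row i
lam : (n m : ℕ) → PP → ℕ → ℕ
lam n m c zero    = n + m ∸ 1
lam n m c (suc i) = count n (λ j → 2 ≤ᵇ c i j)

-- r = 1: (1-indexed) row i+1, for 1 ≤ i+1 ≤ n+m-1, with k ones is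
-- replaced by: parts ≥ 2 unchanged, and ones exactly in the (1-indexed)
-- columns λ_{i+1}+1, …, λ_i - k.
β₁ : (n m : ℕ) → PP → PP
β₁ n m c i j =
  if (2 ≤ᵇ c i j) then c i j
  else (if (n + m ∸ 1) ≤ᵇ i then c i j
  else (if (lam n m c (suc i) ≤ᵇ j) ∧ (suc j ≤ᵇ (lam n m c i ∸ k)) then 1 else 0))
  where
  k : ℕ
  k = count n (λ j' → c i j' ≡ᵇ 1)

β : (n m r : ℕ) → PP → PP
β n m zero          c = c
β n m (suc zero)    c = β₁ n m c
β n m (suc (suc r)) c = βBK n m (suc (suc r)) c

{-# OPTIONS --safe #-}
module Submission where

-- The entry b_{ij} of Ψ c is n − ℓ^k_ρ(c) with ρ = n+m−j and k = j−i+1.  β_r only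
-- exchanges entries r and r − 1 (β₁ only moves ones), and a threshold k ≠ r cannot
-- tell r from r − 1; so off the diagonal k = r, where π_r does nothing, both sides
-- agree.  On that diagonal let row ρ have parts > r before position p, r before q
-- and r − 1 before s.  An r is frozen by an r − 1 below it, i.e. before
-- ℓ^{r−1}_{ρ+1}; an r − 1 by an r above it or by sitting in column n+m−r+1, i.e.
-- from ℓ^{r+1}_{ρ−1} on.  Hence the free entries fill [lo, hi) with
-- lo = max(p, ℓ^{r−1}_{ρ+1}) and hi = min(ℓ^{r+1}_{ρ−1}, s), and swapping their
-- q − lo letters r with their hi − q letters r − 1 leaves lo + (hi − q) parts ≥ r.
-- The flip of b_{ij} computes n − (lo + (hi − q)) from exactly these neighbours.
-- For r = 1 the same count, with lo = ℓ^2_ρ and hi = λ_{ρ−1}, is the definition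
-- of β₁.

open import Defs
open import Data.Bool using (Bool; true; false; if_then_else_; _∧_; _∨_; not)
open import Data.Bool.Properties using (∧-zeroʳ; ∧-identityʳ; ∨-zeroʳ; T-≡; ¬-not)
  renaming (_≟_ to _≟ᵇ_)
open import Data.Nat
open import Data.Nat.Properties
open import Data.Nat.Tactic.RingSolver using (solve-∀)
open import Data.Product using (_,_)
open import Data.Sum using (_⊎_; inj₁; inj₂)
open import Function.Bundles using (Equivalence)
open import Relation.Binary.PropositionalEquality
open import Relation.Nullary using (yes; no)
open import Relation.Nullary.Decidable using (dec-true; dec-false)
open import Relation.Nullary.Negation using (contradiction)

open ≡-Reasoning

-- `does (m ≤? n)` computes to `m ≤ᵇ n` (likewise for `<?` and `≟`), so the
-- decision procedures certify the boolean tests of the definitions.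

≤ᵇ-true : ∀ {m n} → m ≤ n → (m ≤ᵇ n) ≡ true
≤ᵇ-true {m} {n} = dec-true (m ≤? n)

≤ᵇ-false : ∀ {m n} → n < m → (m ≤ᵇ n) ≡ false
≤ᵇ-false {m} {n} n<m = dec-false (m ≤? n) (<⇒≱ n<m)

≤ᵇ-sound : ∀ {m n} → (m ≤ᵇ n) ≡ true → m ≤ n
≤ᵇ-sound {m} {n} e = ≤ᵇ⇒≤ m n (Equivalence.from T-≡ e)

<ᵇ-true : ∀ {m n} → m < n → (m <ᵇ n) ≡ true
<ᵇ-true {m} {n} = dec-true (m <? n)

<ᵇ-false : ∀ {m n} → n ≤ m → (m <ᵇ n) ≡ false
<ᵇ-false {m} {n} n≤m = dec-false (m <? n) (≤⇒≯ n≤m)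

≡ᵇ-true : ∀ {m n} → m ≡ n → (m ≡ᵇ n) ≡ true
≡ᵇ-true {m} {n} = dec-true (m ≟ n)

≡ᵇ-false : ∀ {m n} → m ≢ n → (m ≡ᵇ n) ≡ false
≡ᵇ-false {m} {n} = dec-false (m ≟ n)

if-either : ∀ {A : Set} b {x y : A} → (if b then x else y) ≡ x ⊎ (if b then x else y) ≡ y
if-either true  = inj₁ refl
if-either false = inj₂ refl

m+n≡o⇒o∸m≡n : ∀ m n {o} → m + n ≡ o → o ∸ m ≡ n
m+n≡o⇒o∸m≡n m n refl = m+n∸m≡n m n

m∸[n∸o]≡o+[m∸n] : ∀ {m n o} → o ≤ n → n ≤ m → m ∸ (n ∸ o) ≡ o + (m ∸ n)
m∸[n∸o]≡o+[m∸n] {m} {n} {o} o≤n n≤m = begin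
  m ∸ (n ∸ o)              ≡⟨ cong (_∸ (n ∸ o)) (m∸n+n≡m n≤m) ⟨
  (m ∸ n) + n ∸ (n ∸ o)    ≡⟨ +-∸-assoc (m ∸ n) (m∸n≤m n o) ⟩
  (m ∸ n) + (n ∸ (n ∸ o))  ≡⟨ cong ((m ∸ n) +_) (m∸[m∸n]≡n o≤n) ⟩
  (m ∸ n) + o              ≡⟨ +-comm (m ∸ n) o ⟩
  o + (m ∸ n)              ∎

flip-arith : ∀ {n x y z} → x ≤ z → z ≤ y → y ≤ n →
             ((n ∸ x) + (n ∸ y)) ∸ (n ∸ z) ≡ n ∸ (x + (y ∸ z))
flip-arith {x = x} x≤z z≤y y≤n
  with d , refl ← m≤n⇒∃[o]m+o≡n x≤z
     | e , refl ← m≤n⇒∃[o]m+o≡n z≤y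
     | f , refl ← m≤n⇒∃[o]m+o≡n y≤n = begin
  ((x + d + e + f ∸ x) + (x + d + e + f ∸ (x + d + e))) ∸ (x + d + e + f ∸ (x + d))
    ≡⟨ cong₂ _∸_ (cong₂ _+_ (m+n≡o⇒o∸m≡n x (d + e + f) (regroup₁ x d e f)) (m+n∸m≡n (x + d + e) f))
                 (m+n≡o⇒o∸m≡n (x + d) (e + f) (sym (+-assoc (x + d) e f))) ⟩
  ((d + e + f) + f) ∸ (e + f)
    ≡⟨ m+n≡o⇒o∸m≡n (e + f) (d + f) (regroup₂ d e f) ⟩
  d + f
    ≡⟨ m+n≡o⇒o∸m≡n (x + e) (d + f) (regroup₃ x d e f) ⟨
  (x + d + e + f) ∸ (x + e)
    ≡⟨ cong (λ u → x + d + e + f ∸ (x + u)) (m+n∸m≡n (x + d) e) ⟨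
  x + d + e + f ∸ (x + (x + d + e ∸ (x + d))) ∎
  where
  regroup₁ : ∀ x d e f → x + (d + e + f) ≡ x + d + e + f
  regroup₁ = solve-∀
  regroup₂ : ∀ d e f → (e + f) + (d + f) ≡ (d + e + f) + f
  regroup₂ = solve-∀
  regroup₃ : ∀ x d e f → (x + e) + (d + f) ≡ x + d + e + f
  regroup₃ = solve-∀

antitone : ∀ {f : ℕ → ℕ} → (∀ x → f (suc x) ≤ f x) → ∀ {x y} → x ≤ y → f y ≤ f x
antitone {f} step x≤y = go (≤⇒≤′ x≤y)
  where
  go : ∀ {x y} → x ≤′ y → f y ≤ f x
  go ≤′-refl       = ≤-refl
  go (≤′-step x≤y) = ≤-trans (step _) (go x≤y)

count-≤ : ∀ N p → count N p ≤ N
count-≤ zero    p = z≤n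
count-≤ (suc N) p with p N
... | true  = s≤s (count-≤ N p)
... | false = m≤n⇒m≤1+n (count-≤ N p)

count-cong : ∀ N {p q} → (∀ l → l < N → p l ≡ q l) → count N p ≡ count N q
count-cong zero    _   = refl
count-cong (suc N) p≗q = cong₂ (λ b k → (if b then 1 else 0) + k) (p≗q N ≤-refl)
                               (count-cong N (λ l l<N → p≗q l (m<n⇒m<1+n l<N)))

count-bound : ∀ N {p K} → (∀ l → l < N → p l ≡ true → l < K) → count N p ≤ K
count-bound zero    _ = z≤n
count-bound (suc N) {p} bound with p N in e
... | true  = ≤-trans (s≤s (count-≤ N p)) (bound N ≤-refl e)
... | false = count-bound N (λ l l<N → bound l (m<n⇒m<1+n l<N))

count-≥ : ∀ N {p K} → K ≤ N → (∀ l → l < K → p l ≡ true) → K ≤ count N p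
count-≥ zero    z≤n _ = z≤n
count-≥ (suc N) {p} K≤1+N inside with m≤n⇒m<n∨m≡n K≤1+N
... | inj₁ K<1+N = ≤-trans (count-≥ N (≤-pred K<1+N) inside) (m≤n+m (count N p) _)
... | inj₂ refl rewrite inside N ≤-refl = s≤s (count-≥ N ≤-refl (λ l l<N → inside l (m<n⇒m<1+n l<N)))

count-interval : ∀ N {p lo hi} → lo ≤ hi → hi ≤ N →
                 (∀ l → l < lo → p l ≡ false) →
                 (∀ l → lo ≤ l → l < hi → p l ≡ true) →
                 (∀ l → hi ≤ l → l < N → p l ≡ false) →
                 count N p ≡ hi ∸ lo
count-interval zero {lo = lo} _ z≤n _ _ _ = sym (0∸n≡0 lo)
count-interval (suc N) lo≤hi hi≤1+N before inside after with m≤n⇒m<n∨m≡n hi≤1+N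
... | inj₁ hi<1+N rewrite after N (≤-pred hi<1+N) ≤-refl =
  count-interval N lo≤hi (≤-pred hi<1+N) before inside (λ l hi≤l l<N → after l hi≤l (m<n⇒m<1+n l<N))
... | inj₂ refl with m≤n⇒m<n∨m≡n lo≤hi
...   | inj₁ lo<1+N rewrite inside N (≤-pred lo<1+N) ≤-refl =
  trans (cong suc (count-interval N (≤-pred lo<1+N) ≤-refl before
                     (λ l lo≤l l<N → inside l lo≤l (m<n⇒m<1+n l<N))
                     (λ l N≤l l<N → contradiction l<N (≤⇒≯ N≤l))))
        (sym (+-∸-assoc 1 (≤-pred lo<1+N)))
...   | inj₂ refl rewrite before N ≤-refl =
  count-interval N ≤-refl ≤-refl (λ l l<N → before l (m<n⇒m<1+n l<N))
                 (λ l N≤l l<N → contradiction l<N (≤⇒≯ N≤l))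
                 (λ l N≤l l<N → contradiction l<N (≤⇒≯ N≤l))

count-prefix : ∀ N {p T} → T ≤ N →
               (∀ l → l < T → p l ≡ true) → (∀ l → T ≤ l → l < N → p l ≡ false) →
               count N p ≡ T
count-prefix N T≤N inside after = count-interval N z≤n T≤N (λ _ ()) (λ l _ → inside l) after

anyBelow-true : ∀ N {p i} → i < N → p i ≡ true → anyBelow N p ≡ true
anyBelow-true (suc N) {p} i<1+N pi with m≤n⇒m<n∨m≡n (≤-pred i<1+N)
... | inj₁ i<N  = trans (cong (p N ∨_) (anyBelow-true N i<N pi)) (∨-zeroʳ (p N))
... | inj₂ refl rewrite pi = refl

anyBelow-false : ∀ N {p} → (∀ i → i < N → p i ≡ false) → anyBelow N p ≡ false
anyBelow-false zero    _    = refl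
anyBelow-false (suc N) none rewrite none N ≤-refl = anyBelow-false N (λ i i<N → none i (m<n⇒m<1+n i<N))

Ψ-at : ∀ {n m c i j a k} → j + suc a ≡ n + m → i + k ≡ suc j → Ψ n m c i j ≡ n ∸ ell n c (suc a) k
Ψ-at {n} {c = c} {i} {j} {a} {k} hj hk =
  cong₂ (λ ρ κ → n ∸ ell n c ρ κ) (m+n≡o⇒o∸m≡n j (suc a) hj) (m+n≡o⇒o∸m≡n i k hk)

π-at : ∀ {n m r b i j} → i + r ≡ suc j → π n m r b i j ≡ flipAt n m b i j
π-at i+r≡1+j rewrite ≡ᵇ-true (cong (_∸ 1) (sym i+r≡1+j)) = refl

π-off : ∀ {n m r b i j} → 1 ≤ r → i + r ≢ suc j → π n m r b i j ≡ b i j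
π-off {r = r} {i = i} 1≤r i+r≢1+j
  rewrite ≡ᵇ-false (λ j≡ → i+r≢1+j (trans (sym (m+[n∸m]≡n (≤-trans 1≤r (m≤n+m r i))))
                                           (cong suc (sym j≡)))) = refl

flipAt-off : ∀ {n m b i j} → i ≢ j →
             flipAt n m b i j ≡ ((ext n m b (i ∸ 1) j ⊓ ext n m b i (j ∸ 1))
                                  + (ext n m b i (suc j) ⊔ ext n m b (suc i) j)) ∸ ext n m b i j
flipAt-off i≢j rewrite ≡ᵇ-false i≢j = refl

flipAt-diag : ∀ {n m b i} → flipAt n m b i i ≡ (ext n m b (i ∸ 1) i + ext n m b i (suc i)) ∸ ext n m b i i
flipAt-diag {i = i} rewrite ≡ᵇ-true {i} refl = refl

-- Thresholds other than r do not see β_r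

≤ᵇ-blind-suc : ∀ {k v x} → k ≢ suc v → x ≡ suc v ⊎ x ≡ v → (k ≤ᵇ x) ≡ (k ≤ᵇ v)
≤ᵇ-blind-suc         _      (inj₂ refl) = refl
≤ᵇ-blind-suc {k} {v} k≢1+v (inj₁ refl) with k ≤? v
... | yes k≤v = trans (≤ᵇ-true (m≤n⇒m≤1+n k≤v)) (sym (≤ᵇ-true k≤v))
... | no  k≰v = trans (≤ᵇ-false (≤∧≢⇒< (≰⇒> k≰v) (≢-sym k≢1+v))) (sym (≤ᵇ-false (≰⇒> k≰v)))

≤ᵇ-blind-≤1 : ∀ {k x y} → k ≢ 1 → x ≤ 1 → y ≤ 1 → (k ≤ᵇ x) ≡ (k ≤ᵇ y)
≤ᵇ-blind-≤1 {zero}        _   _   _   = refl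
≤ᵇ-blind-≤1 {suc zero}    k≢1 _   _   = contradiction refl k≢1
≤ᵇ-blind-≤1 {suc (suc k)} _   x≤1 y≤1 =
  trans (≤ᵇ-false (s≤s (≤-trans x≤1 (s≤s z≤n)))) (sym (≤ᵇ-false (s≤s (≤-trans y≤1 (s≤s z≤n)))))

module _ {n m : ℕ} {c : PP} where

  free-neither : ∀ {v a l} → c a l ≢ suc v → c a l ≢ v → free n m (suc v) c a l ≡ false
  free-neither ≢r ≢r′ rewrite ≡ᵇ-false ≢r | ≡ᵇ-false ≢r′ = refl

  free-at-r : ∀ {v a l} → c a l ≡ suc v → colHas n m c l (suc v) ≡ true →
              free n m (suc v) c a l ≡ not (colHas n m c l v)
  free-at-r {v = v} e has rewrite e | ≡ᵇ-true {v} refl | has | ≡ᵇ-false (1+n≢n {v}) = ∧-identityʳ _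

  free-at-r′ : ∀ {v a l} → c a l ≡ v → colHas n m c l v ≡ true →
               free n m (suc v) c a l ≡ not (colHas n m c l (suc v)) ∧ not (l ≡ᵇ n + m ∸ suc v)
  free-at-r′ {v} {l = l} e has
    rewrite e | ≡ᵇ-false (≢-sym (1+n≢n {v})) | ≡ᵇ-true {v} refl | has
          | ∧-identityʳ (colHas n m c l (suc v)) = refl

  free-candidate : ∀ {v a l} → free n m (suc v) c a l ≡ true → c a l ≡ suc v ⊎ c a l ≡ v
  free-candidate {v} {a} {l} isFree with c a l ≟ suc v | c a l ≟ v
  ... | yes e  | _      = inj₁ e
  ... | no _   | yes e  = inj₂ e
  ... | no ≢r  | no ≢r′ = contradiction (trans (sym isFree) (free-neither ≢r ≢r′)) λ ()

  βBK-fixed : ∀ {r a l} → free n m r c a l ≡ false → βBK n m r c a l ≡ c a l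
  βBK-fixed e rewrite e = refl

  freeLower : ℕ → ℕ → ℕ → Bool
  freeLower v a l = free n m (suc v) c a l ∧ (c a l ≡ᵇ v)

  becomesR : ℕ → ℕ → ℕ → Bool
  becomesR v a l = count l (free n m (suc v) c a) <ᵇ count n (freeLower v a)

  βBK-moved : ∀ {v a l} → free n m (suc v) c a l ≡ true →
              βBK n m (suc v) c a l ≡ (if becomesR v a l then suc v else v)
  βBK-moved e rewrite e = refl

  βBK-blind : ∀ {v a l k} → k ≢ suc v → (k ≤ᵇ βBK n m (suc v) c a l) ≡ (k ≤ᵇ c a l)
  βBK-blind {v} {a} {l} {k} k≢r with free n m (suc v) c a l ≟ᵇ true
  ... | no  fixed = cong (k ≤ᵇ_) (βBK-fixed (¬-not fixed))
  ... | yes moved = begin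
    k ≤ᵇ βBK n m (suc v) c a l                  ≡⟨ cong (k ≤ᵇ_) (βBK-moved moved) ⟩
    k ≤ᵇ (if becomesR v a l then suc v else v)  ≡⟨ ≤ᵇ-blind-suc k≢r (if-either (becomesR v a l)) ⟩
    k ≤ᵇ v                                      ≡⟨ ≤ᵇ-blind-suc k≢r (free-candidate moved) ⟨
    k ≤ᵇ c a l                                  ∎

  β₁-fixed : ∀ {a l} → 2 ≤ c a l → β₁ n m c a l ≡ c a l
  β₁-fixed 2≤c rewrite ≤ᵇ-true 2≤c = refl

  ones : ℕ → ℕ
  ones a = count n (λ l → c a l ≡ᵇ 1)

  β₁-≤1 : ∀ {a l} → c a l < 2 → β₁ n m c a l ≤ 1
  β₁-≤1 {a} {l} c<2 rewrite ≤ᵇ-false c<2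
    with n + m ∸ 1 ≤ᵇ a | (lam n m c (suc a) ≤ᵇ l) ∧ (suc l ≤ᵇ lam n m c a ∸ ones a)
  ... | true  | _     = ≤-pred c<2
  ... | false | true  = ≤-refl
  ... | false | false = z≤n

  β₁-blind : ∀ {a l k} → k ≢ 1 → (k ≤ᵇ β₁ n m c a l) ≡ (k ≤ᵇ c a l)
  β₁-blind {a} {l} {k} k≢1 with 2 ≤? c a l
  ... | yes 2≤c = cong (k ≤ᵇ_) (β₁-fixed 2≤c)
  ... | no  2≰c = ≤ᵇ-blind-≤1 k≢1 (β₁-≤1 (≰⇒> 2≰c)) (≤-pred (≰⇒> 2≰c))

  β-blind : ∀ {r a l k} → k ≢ r → (k ≤ᵇ β n m r c a l) ≡ (k ≤ᵇ c a l)
  β-blind {r = zero}        _ = refl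
  β-blind {r = suc zero}      = β₁-blind
  β-blind {r = suc (suc t)}   = βBK-blind

  ell-β : ∀ {r ρ k} → k ≢ r → ell n (β n m r c) ρ k ≡ ell n c ρ k
  ell-β {r} {ρ} {k} k≢r = count-cong n (λ l _ → β-blind {r} {ρ ∸ 1} {l} {k} k≢r)

  Ψ-β-off : ∀ {r i j} → i ≤ suc j → i + r ≢ suc j → Ψ n m (β n m r c) i j ≡ Ψ n m c i j
  Ψ-β-off {r} {i} {j} i≤1+j i+r≢1+j =
    cong (n ∸_) (ell-β {r} {n + m ∸ j}
                       (λ k≡r → i+r≢1+j (trans (cong (i +_) (sym k≡r)) (m+[n∸m]≡n i≤1+j))))

  module _ (c∈C : InC n m c) where
    open InC c∈C

    col-weak : ∀ a l → c (suc a) l ≤ c a l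
    col-weak a l with 0 <? c (suc a) l
    ... | yes pos = <⇒≤ (colStrict a l pos)
    ... | no ¬pos = ≤-trans (≮⇒≥ ¬pos) z≤n

    col-antitone : ∀ {a a′ l} → a ≤ a′ → c a′ l ≤ c a l
    col-antitone {l = l} = antitone (λ a → col-weak a l)

    row-antitone : ∀ {a l l′} → l ≤ l′ → c a l′ ≤ c a l
    row-antitone {a} = antitone (rowWeak a)

    entry-bound : ∀ {a l k} → 1 ≤ k → k ≤ c a l → a + l + k < n + m
    entry-bound {zero} {l} {k} 1≤k k≤c = ≤-trans (+-monoʳ-≤ (suc l) k≤) (≤-reflexive (m+[n∸m]≡n (<⇒≤ l<N)))
      where
      k≤ : k ≤ n + m ∸ suc l
      k≤ = ≤-trans k≤c (colBound zero l)
      l<N : suc l < n + m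
      l<N = m∸n≢0⇒n<m (λ eq → <⇒≢ (<-≤-trans 1≤k k≤) (sym eq))
    entry-bound {suc a} {l} {k} 1≤k k≤c =
      subst (_< n + m) (+-suc (a + l) k)
            (entry-bound z<s (≤-trans (s≤s k≤c) (colStrict a l (<-≤-trans 1≤k k≤c))))

    colHas-true : ∀ {i l v} → 1 ≤ v → c i l ≡ v → colHas n m c l v ≡ true
    colHas-true {i} {l} {v} 1≤v e = anyBelow-true (n + m) i<N (≡ᵇ-true e)
      where
      i<N : i < n + m
      i<N = ≤-<-trans (≤-trans (m≤m+n i l) (m≤m+n (i + l) v)) (entry-bound 1≤v (≤-reflexive (sym e)))

    colHas-false : ∀ {l v} → (∀ i → c i l ≢ v) → colHas n m c l v ≡ false
    colHas-false none = anyBelow-false (n + m) (λ i _ → ≡ᵇ-false (none i))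

    column-gap : ∀ {a l v} → c (suc a) l < v → v < c a l → ∀ i → c i l ≢ v
    column-gap {a} below above i with i ≤? a
    ... | yes i≤a = >⇒≢ (<-≤-trans above (col-antitone i≤a))
    ... | no  i≰a = <⇒≢ (≤-<-trans (col-antitone (≰⇒> i≰a)) below)

    column-top : ∀ {l v} → c 0 l < v → ∀ i → c i l ≢ v
    column-top below i = <⇒≢ (≤-<-trans (col-antitone z≤n) below)

    -- ℓ a k is the paper's ℓ^k_{a+1}(c): the rows of c are 0-indexed.
    opaque
      ℓ : ℕ → ℕ → ℕ
      ℓ a = ell n c (suc a)

    opaque
      unfolding ℓ

      ℓ-def : ∀ {a k} → ℓ a k ≡ ell n c (suc a) k
      ℓ-def = refl

      ℓ≤n : ∀ {a k} → ℓ a k ≤ n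
      ℓ≤n = count-≤ n _

      ℓ-bound : ∀ {a k K} → (∀ l → l < n → k ≤ c a l → l < K) → ℓ a k ≤ K
      ℓ-bound h = count-bound n (λ l l<n e → h l l<n (≤ᵇ-sound e))

      ≤c⇒<ℓ : ∀ {a k l} → l < n → k ≤ c a l → l < ℓ a k
      ≤c⇒<ℓ l<n k≤c = count-≥ n l<n (λ l′ l′≤l → ≤ᵇ-true (≤-trans k≤c (row-antitone (≤-pred l′≤l))))

    c<⇒ℓ≤ : ∀ {a k l} → c a l < k → ℓ a k ≤ l
    c<⇒ℓ≤ c<k = ℓ-bound (λ l′ _ k≤c → ≰⇒> (λ l≤l′ → <⇒≱ c<k (≤-trans k≤c (row-antitone l≤l′))))

    <ℓ⇒≤c : ∀ {a k l} → l < ℓ a k → k ≤ c a l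
    <ℓ⇒≤c l<ℓ = ≮⇒≥ (λ c<k → <⇒≱ l<ℓ (c<⇒ℓ≤ c<k))

    ℓ≤⇒c< : ∀ {a k l} → l < n → ℓ a k ≤ l → c a l < k
    ℓ≤⇒c< l<n ℓ≤l = ≰⇒> (λ k≤c → <⇒≱ (≤c⇒<ℓ l<n k≤c) ℓ≤l)

    ℓ-between : ∀ {a v l} → ℓ a (suc v) ≤ l → l < ℓ a v → c a l ≡ v
    ℓ-between ℓ≤l l<ℓ = ≤-antisym (≤-pred (ℓ≤⇒c< (<-≤-trans l<ℓ ℓ≤n) ℓ≤l)) (<ℓ⇒≤c l<ℓ)

    ℓ-antitone : ∀ {a k k′} → k ≤ k′ → ℓ a k′ ≤ ℓ a k
    ℓ-antitone k≤k′ = ℓ-bound (λ l l<n k′≤c → ≤c⇒<ℓ l<n (≤-trans k≤k′ k′≤c))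

    ℓ-antitone-row : ∀ {a a′ k} → a ≤ a′ → ℓ a′ k ≤ ℓ a k
    ℓ-antitone-row a≤a′ = ℓ-bound (λ l l<n k≤c → ≤c⇒<ℓ l<n (≤-trans k≤c (col-antitone a≤a′)))

    ℓ-below : ∀ {a k} → 1 ≤ k → ℓ (suc a) k ≤ ℓ a (suc k)
    ℓ-below {a} 1≤k =
      ℓ-bound (λ l l<n k≤c → ≤c⇒<ℓ l<n (≤-trans (s≤s k≤c) (colStrict a l (<-≤-trans 1≤k k≤c))))

    ℓ-zero : ∀ {a k} → 1 ≤ k → n + m ≤ k + a → ℓ a k ≡ 0
    ℓ-zero {a} {k} 1≤k N≤k+a = n≤0⇒n≡0 (ℓ-bound (λ l _ k≤c →
      contradiction (entry-bound 1≤k k≤c)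
                    (≤⇒≯ (≤-trans N≤k+a (≤-trans (≤-reflexive (+-comm k a))
                                                 (+-monoˡ-≤ k (m≤m+n a l)))))))

    ℓ-top : ∀ {k} → 1 ≤ k → ℓ 0 k ≤ n + m ∸ k
    ℓ-top 1≤k = ℓ-bound (λ l _ k≤c → m+n≤o⇒m≤o∸n (suc l) (entry-bound 1≤k k≤c))

    -- ℓ⁺ ρ k = ℓ^k_ρ(c) with the paper's row indices, extended by a fictitious
    -- row ℓ⁺ 0 k = n+m+1−k; this encodes the boundary conventions b_{0,j} = n and
    -- b_{i,n+m} = n − i of the flips, and λ_0 = n+m−1 of β₁.
    ℓ⁺ : ℕ → ℕ → ℕ
    ℓ⁺ zero    k = suc (n + m) ∸ k
    ℓ⁺ (suc a) k = ℓ a k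

    ℓ≤ℓ⁺ : ∀ {a k} → 1 ≤ k → ℓ a k ≤ ℓ⁺ a (suc k)
    ℓ≤ℓ⁺ {zero}  = ℓ-top
    ℓ≤ℓ⁺ {suc a} = ℓ-below

    ℓ⁺≤ : ∀ {a k} → ℓ⁺ a (suc k) ≤ n + m ∸ k
    ℓ⁺≤ {zero}      = ≤-refl
    ℓ⁺≤ {suc a} {k} = ≤-trans (ℓ-antitone-row z≤n) (≤-trans (ℓ-top z<s) (∸-monoʳ-≤ (n + m) (n≤1+n k)))

    ℓ⁺₂≤n : m ≤ 1 → ∀ {a} → ℓ⁺ a 2 ≤ n
    ℓ⁺₂≤n m≤1 {a} = ≤-trans (ℓ⁺≤ {a} {1})
      (m≤n+o⇒m∸n≤o (n + m) 1 (≤-trans (+-monoʳ-≤ n m≤1) (≤-reflexive (+-comm n 1))))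

    lam≡ℓ⁺ : ∀ a → lam n m c a ≡ ℓ⁺ a 2
    lam≡ℓ⁺ zero    = refl
    lam≡ℓ⁺ (suc a) = sym ℓ-def

    no-successor-above : ∀ {a l v} → c a l ≡ v → l < ℓ⁺ a (suc (suc v)) → colHas n m c l (suc v) ≡ false
    no-successor-above {zero}  e _   = colHas-false (column-top (≤-reflexive (cong suc e)))
    no-successor-above {suc a} e l<ℓ = colHas-false (column-gap (≤-reflexive (cong suc e)) (<ℓ⇒≤c l<ℓ))

    successor-above-or-edge : ∀ {a l v} → l < n → 1 ≤ v → c a l ≡ v → ℓ⁺ a (suc (suc v)) ≤ l →
                              colHas n m c l (suc v) ≡ true ⊎ l ≡ n + m ∸ suc v
    successor-above-or-edge {zero} {l} {v} _ 1≤v e ℓ⁺≤l =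
      inj₂ (≤-antisym (m+n≤o⇒m≤o∸n l (subst (_≤ n + m) (sym (+-suc l v))
                                           (entry-bound 1≤v (≤-reflexive (sym e)))))
                      ℓ⁺≤l)
    successor-above-or-edge {suc a} {l} {v} l<n 1≤v e ℓ≤l =
      inj₁ (colHas-true z<s (≤-antisym (≤-pred (ℓ≤⇒c< l<n ℓ≤l)) r≤c))
      where
      r≤c : suc v ≤ c a l
      r≤c = ≤-trans (s≤s (≤-reflexive (sym e))) (colStrict a l (<-≤-trans 1≤v (≤-reflexive (sym e))))

    ext-Ψ : ∀ i j {ρ k} → j + ρ ≡ n + m → i + k ≡ suc j → ext n m (Ψ n m c) i j ≡ n ∸ ℓ⁺ ρ k
    ext-Ψ zero    j {zero}  hj refl =
      cong (n ∸_) (sym (m≤n⇒m∸n≡0 (≤-reflexive (trans (sym hj) (+-identityʳ j)))))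
    ext-Ψ zero    j {suc a} hj refl =
      cong (n ∸_) (sym (ℓ-zero z<s (≤-reflexive (trans (sym hj) (+-suc j a)))))
    ext-Ψ (suc i) j {zero}  {k} hj hk with refl ← trans (sym (+-identityʳ j)) hj
      rewrite ≡ᵇ-true {n + m} refl =
      cong (n ∸_) (sym (m+n≡o⇒o∸m≡n k (suc i) (trans (+-comm k (suc i)) hk)))
    ext-Ψ (suc i) j {suc a} {k} hj hk
      rewrite ≡ᵇ-false (<⇒≢ (<-≤-trans (m<m+n j z<s) (≤-reflexive hj))) =
      trans (Ψ-at {n} {m} {c} {suc i} hj hk) (cong (n ∸_) (sym ℓ-def))

    -- Row a has parts > r before p, r before q and r′ = r − 1 before s; an r is
    -- frozen before B, an r′ from C on.
    module BKRow (t a : ℕ) where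
      r r′ : ℕ
      r  = suc (suc t)
      r′ = suc t

      p q s B C lo hi : ℕ
      p  = ℓ a (suc r)
      q  = ℓ a r
      s  = ℓ a r′
      B  = ℓ (suc a) r′
      C  = ℓ⁺ a (suc r)
      lo = p ⊔ B
      hi = C ⊓ s

      lo≤q : lo ≤ q
      lo≤q = ⊔-lub (ℓ-antitone (n≤1+n r)) (ℓ-below z<s)

      q≤hi : q ≤ hi
      q≤hi = ⊓-glb (ℓ≤ℓ⁺ z<s) (ℓ-antitone (n≤1+n r′))

      hi≤n : hi ≤ n
      hi≤n = ≤-trans (m⊓n≤n C s) ℓ≤n

      isFree : ℕ → Bool
      isFree = free n m r c a

      r-free : ∀ {l} → l < n → c a l ≡ r → B ≤ l → isFree l ≡ true
      r-free l<n e B≤l = trans (free-at-r e (colHas-true z<s e))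
        (cong not (colHas-false (column-gap (ℓ≤⇒c< l<n B≤l) (≤-reflexive (sym e)))))

      r-frozen : ∀ {l} → c a l ≡ r → l < B → isFree l ≡ false
      r-frozen {l} e l<B = trans (free-at-r e (colHas-true z<s e)) (cong not (colHas-true z<s r′-below))
        where
        r′≤ : r′ ≤ c (suc a) l
        r′≤ = <ℓ⇒≤c l<B
        r′-below : c (suc a) l ≡ r′
        r′-below = ≤-antisym (≤-pred (≤-trans (colStrict a l (<-≤-trans z<s r′≤)) (≤-reflexive e))) r′≤

      r′-free : ∀ {l} → c a l ≡ r′ → l < C → isFree l ≡ true
      r′-free e l<C = trans (free-at-r′ e (colHas-true z<s e))
        (cong₂ (λ x y → not x ∧ not y) (no-successor-above e l<C)
                                       (≡ᵇ-false (<⇒≢ (<-≤-trans l<C (ℓ⁺≤ {a} {r})))))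

      r′-frozen : ∀ {l} → l < n → c a l ≡ r′ → C ≤ l → isFree l ≡ false
      r′-frozen l<n e C≤l with successor-above-or-edge l<n z<s e C≤l
      ... | inj₁ has-r rewrite free-at-r′ e (colHas-true z<s e) | has-r = refl
      ... | inj₂ edge  rewrite free-at-r′ e (colHas-true z<s e) | ≡ᵇ-true edge = ∧-zeroʳ _

      free-before : ∀ {l} → l < n → l < lo → isFree l ≡ false
      free-before {l} l<n l<lo with l <? p
      ... | yes l<p = free-neither (>⇒≢ r<c) (>⇒≢ (<-trans (n<1+n r′) r<c))
        where
        r<c : r < c a l
        r<c = <ℓ⇒≤c l<p
      ... | no  l≮p = r-frozen (ℓ-between (≮⇒≥ l≮p) (<-≤-trans l<lo lo≤q))
                               (≰⇒> (λ B≤l → <⇒≱ l<lo (⊔-lub (≮⇒≥ l≮p) B≤l)))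

      free-inside : ∀ {l} → l < n → lo ≤ l → l < hi → isFree l ≡ true
      free-inside {l} l<n lo≤l l<hi with l <? q
      ... | yes l<q = r-free l<n (ℓ-between (≤-trans (m≤m⊔n p B) lo≤l) l<q) (≤-trans (m≤n⊔m p B) lo≤l)
      ... | no  l≮q = r′-free (ℓ-between (≮⇒≥ l≮q) (<-≤-trans l<hi (m⊓n≤n C s))) (<-≤-trans l<hi (m⊓n≤m C s))

      free-after : ∀ {l} → l < n → hi ≤ l → isFree l ≡ false
      free-after {l} l<n hi≤l with l <? s
      ... | no  l≮s = free-neither (<⇒≢ (<-trans c<r′ (n<1+n r′))) (<⇒≢ c<r′)
        where
        c<r′ : c a l < r′
        c<r′ = ℓ≤⇒c< l<n (≮⇒≥ l≮s)
      ... | yes l<s = r′-frozen l<n (ℓ-between (≤-trans q≤hi hi≤l) l<s)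
                                 (≮⇒≥ (λ l<C → <⇒≱ (⊓-glb l<C l<s) hi≤l))

      free-rank : ∀ {l} → lo ≤ l → l ≤ hi → count l isFree ≡ l ∸ lo
      free-rank {l} lo≤l l≤hi = count-interval l lo≤l ≤-refl
        (λ x x<lo → free-before (<-≤-trans x<lo (≤-trans lo≤l l≤n)) x<lo)
        (λ x lo≤x x<l → free-inside (<-≤-trans x<l l≤n) lo≤x (<-≤-trans x<l l≤hi))
        (λ x l≤x x<l → contradiction x<l (≤⇒≯ l≤x))
        where
        l≤n : l ≤ n
        l≤n = ≤-trans l≤hi hi≤n

      count-freeLower : count n (freeLower r′ a) ≡ hi ∸ q
      count-freeLower = count-interval n q≤hi hi≤n
        (λ l l<q → trans (cong (isFree l ∧_) (≡ᵇ-false (>⇒≢ (<ℓ⇒≤c l<q)))) (∧-zeroʳ _))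
        (λ l q≤l l<hi → cong₂ _∧_ (free-inside (<-≤-trans l<hi hi≤n) (≤-trans lo≤q q≤l) l<hi)
                                  (≡ᵇ-true (ℓ-between q≤l (<-≤-trans l<hi (m⊓n≤n C s)))))
        (λ l hi≤l l<n → cong (_∧ (c a l ≡ᵇ r′)) (free-after l<n hi≤l))

      βBK-inside : ∀ {l} → lo ≤ l → l < hi → βBK n m r c a l ≡ (if l ∸ lo <ᵇ hi ∸ q then r else r′)
      βBK-inside lo≤l l<hi = trans (βBK-moved (free-inside (<-≤-trans l<hi hi≤n) lo≤l l<hi))
        (cong₂ (λ x y → if x <ᵇ y then r else r′) (free-rank lo≤l (<⇒≤ l<hi)) count-freeLower)

      ℓ-βBK : ell n (βBK n m r c) (suc a) r ≡ lo + (hi ∸ q)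
      ℓ-βBK = count-prefix n (≤-trans T≤hi hi≤n) before after
        where
        T≤hi : lo + (hi ∸ q) ≤ hi
        T≤hi = ≤-trans (+-monoˡ-≤ (hi ∸ q) lo≤q) (≤-reflexive (m+[n∸m]≡n q≤hi))

        before : ∀ l → l < lo + (hi ∸ q) → (r ≤ᵇ βBK n m r c a l) ≡ true
        before l l<T with l <? lo
        ... | yes l<lo = trans (cong (r ≤ᵇ_) (βBK-fixed (free-before (<-≤-trans l<lo (≤-trans lo≤q ℓ≤n)) l<lo)))
                               (≤ᵇ-true (<ℓ⇒≤c (<-≤-trans l<lo lo≤q)))
        ... | no  l≮lo = trans (cong (r ≤ᵇ_) (βBK-inside (≮⇒≥ l≮lo) (<-≤-trans l<T T≤hi)))
                               (trans (cong (λ b → r ≤ᵇ (if b then r else r′)) (<ᵇ-true rank<))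
                                      (≤ᵇ-true {r} ≤-refl))
          where
          rank< : l ∸ lo < hi ∸ q
          rank< = subst (l ∸ lo <_) (m+n∸m≡n lo (hi ∸ q)) (∸-monoˡ-< l<T (≮⇒≥ l≮lo))

        after : ∀ l → lo + (hi ∸ q) ≤ l → l < n → (r ≤ᵇ βBK n m r c a l) ≡ false
        after l T≤l l<n with l <? hi
        ... | no  l≮hi = trans (cong (r ≤ᵇ_) (βBK-fixed (free-after l<n (≮⇒≥ l≮hi))))
                               (≤ᵇ-false (ℓ≤⇒c< l<n (≤-trans q≤hi (≮⇒≥ l≮hi))))
        ... | yes l<hi = trans (cong (r ≤ᵇ_) (βBK-inside (≤-trans (m≤m+n lo (hi ∸ q)) T≤l) l<hi))
                               (trans (cong (λ b → r ≤ᵇ (if b then r else r′)) (<ᵇ-false rank≥))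
                                      (≤ᵇ-false {r} {r′} ≤-refl))
          where
          rank≥ : hi ∸ q ≤ l ∸ lo
          rank≥ = subst (_≤ l ∸ lo) (m+n∸m≡n lo (hi ∸ q)) (∸-monoˡ-≤ lo T≤l)

      flip-Ψ : ∀ i₀ → suc i₀ + r′ + suc a ≡ n + m →
               flipAt n m (Ψ n m c) (suc i₀) (suc i₀ + r′) ≡ n ∸ (lo + (hi ∸ q))
      flip-Ψ i₀ hj = begin
        flipAt n m b i j
          ≡⟨ flipAt-off {n} {m} {b} {i} (<⇒≢ (m<m+n i z<s)) ⟩
        ((ext n m b i₀ j ⊓ ext n m b i (j ∸ 1)) + (ext n m b i (suc j) ⊔ ext n m b (suc i) j)) ∸ ext n m b i j
          ≡⟨ cong₂ _∸_ (cong₂ _+_ (cong₂ _⊓_ (ext-Ψ i₀ j hj k-above)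
                                             (ext-Ψ i (j ∸ 1) (trans (+-suc (i₀ + r′) (suc a)) hj) refl))
                                  (cong₂ _⊔_ (ext-Ψ i (suc j) (trans (sym (+-suc j a)) hj) (cong suc k-above))
                                             (ext-Ψ (suc i) j hj refl)))
                       (ext-Ψ i j hj (cong suc (+-suc i₀ r′))) ⟩
        (((n ∸ p) ⊓ (n ∸ B)) + ((n ∸ C) ⊔ (n ∸ s))) ∸ (n ∸ q)
          ≡⟨ cong₂ (λ x y → (x + y) ∸ (n ∸ q)) (∸-distribˡ-⊔-⊓ n p B) (∸-distribˡ-⊓-⊔ n C s) ⟨
        ((n ∸ lo) + (n ∸ hi)) ∸ (n ∸ q)
          ≡⟨ flip-arith lo≤q q≤hi hi≤n ⟩
        n ∸ (lo + (hi ∸ q)) ∎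
        where
        b : Arr
        b = Ψ n m c
        i j : ℕ
        i = suc i₀
        j = suc i₀ + r′
        k-above : i₀ + suc r ≡ suc j
        k-above = trans (+-suc i₀ r) (cong suc (+-suc i₀ r′))

    module B₁Row (m≤1 : m ≤ 1) (a : ℕ) (a+1<N : suc a < n + m) where
      ones≡ : ones a ≡ ℓ a 1 ∸ ℓ a 2
      ones≡ = count-interval n (ℓ-antitone (n≤1+n 1)) ℓ≤n
        (λ l l<ℓ₂ → ≡ᵇ-false (>⇒≢ (<ℓ⇒≤c l<ℓ₂)))
        (λ l ℓ₂≤l l<ℓ₁ → ≡ᵇ-true (ℓ-between ℓ₂≤l l<ℓ₁))
        (λ l ℓ₁≤l l<n → ≡ᵇ-false (<⇒≢ (ℓ≤⇒c< l<n ℓ₁≤l)))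

      T₁ : ℕ
      T₁ = lam n m c a ∸ ones a

      T₁≡ : T₁ ≡ ℓ a 2 + (ℓ⁺ a 2 ∸ ℓ a 1)
      T₁≡ = trans (cong₂ _∸_ (lam≡ℓ⁺ a) ones≡) (m∸[n∸o]≡o+[m∸n] (ℓ-antitone (n≤1+n 1)) (ℓ≤ℓ⁺ z<s))

      β₁-small : ∀ {l} → c a l < 2 → (1 ≤ᵇ β₁ n m c a l) ≡ (l <ᵇ T₁)
      β₁-small {l} c<2
        rewrite ≤ᵇ-false c<2 | ≤ᵇ-false (∸-monoˡ-< a+1<N (s≤s z≤n))
              | trans (cong (_≤ᵇ l) (sym ℓ-def)) (≤ᵇ-true (c<⇒ℓ≤ {a} {2} {l} c<2))
        with l <ᵇ T₁
      ... | true  = refl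
      ... | false = refl

      ℓ-β₁ : ell n (β₁ n m c) (suc a) 1 ≡ ℓ a 2 + (ℓ⁺ a 2 ∸ ℓ a 1)
      ℓ-β₁ = trans (count-prefix n T₁≤n before after) T₁≡
        where
        T₁≤n : T₁ ≤ n
        T₁≤n = ≤-trans (m∸n≤m (lam n m c a) (ones a)) (≤-trans (≤-reflexive (lam≡ℓ⁺ a)) (ℓ⁺₂≤n m≤1 {a}))

        ℓ₂≤T₁ : ℓ a 2 ≤ T₁
        ℓ₂≤T₁ = ≤-trans (m≤m+n (ℓ a 2) _) (≤-reflexive (sym T₁≡))

        before : ∀ l → l < T₁ → (1 ≤ᵇ β₁ n m c a l) ≡ true
        before l l<T₁ with 2 ≤? c a l
        ... | yes 2≤c = trans (cong (1 ≤ᵇ_) (β₁-fixed 2≤c)) (≤ᵇ-true (≤-trans (n≤1+n 1) 2≤c))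
        ... | no  2≰c = trans (β₁-small (≰⇒> 2≰c)) (<ᵇ-true l<T₁)

        after : ∀ l → T₁ ≤ l → l < n → (1 ≤ᵇ β₁ n m c a l) ≡ false
        after l T₁≤l l<n = trans (β₁-small (ℓ≤⇒c< l<n (≤-trans ℓ₂≤T₁ T₁≤l))) (<ᵇ-false T₁≤l)

    flip-Ψ-diag : m ≤ 1 → ∀ i₀ {a} → suc i₀ + suc a ≡ n + m →
                  flipAt n m (Ψ n m c) (suc i₀) (suc i₀) ≡ n ∸ (ℓ a 2 + (ℓ⁺ a 2 ∸ ℓ a 1))
    flip-Ψ-diag m≤1 i₀ {a} hj = begin
      flipAt n m b i i
        ≡⟨ flipAt-diag {n} {m} {b} {i} ⟩
      (ext n m b i₀ i + ext n m b i (suc i)) ∸ ext n m b i i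
        ≡⟨ cong₂ _∸_ (cong₂ _+_ (ext-Ψ i₀ i hj (+-comm i₀ 2))
                                (ext-Ψ i (suc i) (trans (sym (+-suc i a)) hj) (+-comm i 2)))
                     (ext-Ψ i i hj (+-comm i 1)) ⟩
      ((n ∸ ℓ a 2) + (n ∸ ℓ⁺ a 2)) ∸ (n ∸ ℓ a 1)
        ≡⟨ flip-arith (ℓ-antitone (n≤1+n 1)) (ℓ≤ℓ⁺ z<s) (ℓ⁺₂≤n m≤1 {a}) ⟩
      n ∸ (ℓ a 2 + (ℓ⁺ a 2 ∸ ℓ a 1)) ∎
      where
      b : Arr
      b = Ψ n m c
      i : ℕ
      i = suc i₀

    flip-Ψ : ∀ {i j r} → 1 ≤ i → 1 ≤ r → (r ≡ 1 → m ≤ 1) → i + r ≡ suc j → j < n + m →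
             flipAt n m (Ψ n m c) i j ≡ Ψ n m (β n m r c) i j
    flip-Ψ {suc i₀} {j} {suc zero} _ _ r≡1⇒m≤1 i+r≡1+j j<N
      with refl ← suc-injective (trans (sym (+-comm (suc i₀) 1)) i+r≡1+j) = begin
      flipAt n m (Ψ n m c) (suc i₀) (suc i₀)  ≡⟨ flip-Ψ-diag m≤1 i₀ hj ⟩
      n ∸ (ℓ a 2 + (ℓ⁺ a 2 ∸ ℓ a 1))         ≡⟨ cong (n ∸_) (B₁Row.ℓ-β₁ m≤1 a a+1<N) ⟨
      n ∸ ell n (β₁ n m c) (suc a) 1          ≡⟨ Ψ-at {n} {m} {β₁ n m c} {suc i₀} hj i+r≡1+j ⟨
      Ψ n m (β₁ n m c) (suc i₀) (suc i₀)      ∎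
      where
      m≤1 : m ≤ 1
      m≤1 = r≡1⇒m≤1 refl
      a : ℕ
      a = n + m ∸ suc (suc i₀)
      hj : suc i₀ + suc a ≡ n + m
      hj = trans (+-suc (suc i₀) a) (m+[n∸m]≡n j<N)
      a+1<N : suc a < n + m
      a+1<N = <-≤-trans (m<n+m (suc a) z<s) (≤-reflexive hj)
    flip-Ψ {suc i₀} {j} {suc (suc t)} _ _ _ i+r≡1+j j<N
      with refl ← suc-injective (trans (sym (+-suc (suc i₀) (suc t))) i+r≡1+j) = begin
      flipAt n m (Ψ n m c) (suc i₀) (suc i₀ + suc t)
        ≡⟨ BKRow.flip-Ψ t a i₀ hj ⟩
      n ∸ (BKRow.lo t a + (BKRow.hi t a ∸ BKRow.q t a))
        ≡⟨ cong (n ∸_) (BKRow.ℓ-βBK t a) ⟨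
      n ∸ ell n (βBK n m (suc (suc t)) c) (suc a) (suc (suc t))
        ≡⟨ Ψ-at {n} {m} {βBK n m (suc (suc t)) c} {suc i₀} hj i+r≡1+j ⟨
      Ψ n m (βBK n m (suc (suc t)) c) (suc i₀) (suc i₀ + suc t) ∎
      where
      a : ℕ
      a = n + m ∸ suc (suc i₀ + suc t)
      hj : suc i₀ + suc t + suc a ≡ n + m
      hj = trans (+-suc (suc i₀ + suc t) a) (m+[n∸m]≡n j<N)

mainTheorem3 : (n m r : ℕ) → 1 ≤ n → 1 ≤ r → r ≤ n + m → (r ≡ 1 → m ≤ 1) →
               (c : PP) → InC n m c →
               (i j : ℕ) → 1 ≤ i → i ≤ j → j ≤ n + m ∸ 1 →
               π n m r (Ψ n m c) i j ≡ Ψ n m (β n m r c) i j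
mainTheorem3 n m r 1≤n 1≤r _ r≡1⇒m≤1 c c∈C i j 1≤i i≤j j≤N∸1 with i + r ≟ suc j
... | no  i+r≢1+j = begin
  π n m r (Ψ n m c) i j     ≡⟨ π-off {b = Ψ n m c} {i} 1≤r i+r≢1+j ⟩
  Ψ n m c i j               ≡⟨ Ψ-β-off {n} {m} {c} (m≤n⇒m≤1+n i≤j) i+r≢1+j ⟨
  Ψ n m (β n m r c) i j     ∎
... | yes i+r≡1+j = begin
  π n m r (Ψ n m c) i j     ≡⟨ π-at {b = Ψ n m c} {i} i+r≡1+j ⟩
  flipAt n m (Ψ n m c) i j  ≡⟨ flip-Ψ c∈C 1≤i 1≤r r≡1⇒m≤1 i+r≡1+j j<N ⟩
  Ψ n m (β n m r c) i j     ∎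
  where
  j<N : j < n + m
  j<N = m≤pred[n]⇒suc[m]≤n {{>-nonZero (≤-trans 1≤n (m≤m+n n m))}} j≤N∸1
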